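{- Let $\mathcal M=(U,\mathcal L)$ be a COM, $X\in\mathcal L$, $S\in\mathrm{Samp}(\mathcal M)$ with $\mathrm{Sep}(X,S)=\varnothing$, and put $\widehat S=X\circ S$ and $\widehat{\widehat S}=\widehat S\setminus\underline X$. Then $\widehat S\in\mathrm{Samp}(F(X))$, $\widehat{\widehat S}\in\mathrm{Samp}(\mathcal M(X))$, the convex subgraphs $[\widehat S]$ of $[X]$ and $[\widehat{\widehat S}]$ of $G(\mathcal M(X))$ are $U$-isomorphic, and $[\widehat S]=[X]\cap[S]\neq\varnothing$.
   Context: Sign vectors $X:U\to\{ -1,0,+1\}$, support $\underline X=\{e:X_e\ne0\}$, $(X\circ Y)_e=X_e$ if $X_e\ne0$ else $Y_e$, $\mathrm{Sep}(X,Y)=\{e:X_eY_e=-1\}$, $X\le Y$ iff $X_e\in\{0,Y_e\}$ for all $e$; $X\setminus A$ is the restriction of $X$ to $U\setminus A$. A COM $\mathcal M=(U,\mathcal L)$ is $\mathcal L\subseteq\{ -1,0,+1\}^U$ satisfying (FS) $X\circ(-Y)\in\mathcal L$ and (SE) for $e\in\mathrm{Sep}(X,Y)$ some $Z\in\mathcal L$ has $Z_e=0$, $Z_f=(X\circ Y)_f$ for $f\notin\mathrm{Sep}(X,Y)$; assumed simple. Topes: maximal elements of $(\mathcal L,\le)$; tope graph $G(\mathcal M)$: topes adjacent iff differing in one coordinate. $F(X)=\{Y\in\mathcal L:X\le Y\}$, $[X]$ the subgraph of $G(\mathcal M)$ induced by topes in $F(X)$; $\mathcal M(X)=(U\setminus\underline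 X,\{Y\setminus\underline X:Y\in\mathcal L\})$ (a simple OM, whose topes are the restrictions of topes of $F(X)$). For a set $\mathcal K$ of sign vectors, $\mathrm{Samp}(\mathcal K)=\{S: S\le Y\text{ for some }Y\in\mathcal K\}$; $\mathrm{Samp}(\mathcal M)=\mathrm{Samp}(\mathcal L)$. For a sample $S$ of a COM, $[S]$ is the subgraph of its tope graph induced by the topes $T\ge S$. For $E_e$ = edges whose endpoints differ in coordinate $e$: graphs $G$ on $\{\pm1\}^U$ and $H$ on $\{\pm1\}^{U\setminus A}$ are $U$-isomorphic if some isomorphism maps each edge of $E_e$ in $G$ to an edge of $E_e$ in $H$. -}

module Defs where

open import Data.Nat using (ℕ)
open import Data.Fin using (Fin)
open import Data.Product using (Σ; ∃; ∃-syntax; _×_; _,_; proj₁; proj₂)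
open import Relation.Binary.PropositionalEquality using (_≡_; _≢_)
open import Relation.Nullary using (¬_)
open import Function.Bundles using (_⇔_)

data Sign : Set where
  ⊖ ⊙ ⊕ : Sign

-ˢ_ : Sign → Sign
-ˢ ⊖ = ⊕
-ˢ ⊙ = ⊙
-ˢ ⊕ = ⊖

_*ˢ_ : Sign → Sign → Sign
⊙ *ˢ _ = ⊙
⊕ *ˢ s = s
⊖ *ˢ s = -ˢ s

_∘ˢ_ : Sign → Sign → Sign
⊙ ∘ˢ y = y
⊕ ∘ˢ _ = ⊕
⊖ ∘ˢ _ = ⊖

data _≤ˢ_ : Sign → Sign → Set where
  ⊙≤ : ∀ {y} → ⊙ ≤ˢ y
  refl≤ : ∀ {y} → y ≤ˢ y

SV : Set → Set
SV I = I → Sign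

module _ {I : Set} where

  -_ : SV I → SV I
  (- X) e = -ˢ X e

  _∘_ : SV I → SV I → SV I
  (X ∘ Y) e = X e ∘ˢ Y e

  _≤_ : SV I → SV I → Set
  X ≤ Y = ∀ e → X e ≤ˢ Y e

  _≈_ : SV I → SV I → Set
  X ≈ Y = ∀ e → X e ≡ Y e

  Sep : SV I → SV I → I → Set
  Sep X Y e = X e *ˢ Y e ≡ ⊖

  SepEmpty : SV I → SV I → Set
  SepEmpty X Y = ∀ e → ¬ Sep X Y e

  SVSet : Set₁
  SVSet = SV I → Set

  Tope : SVSet → SV I → Set
  Tope 𝓛 T = 𝓛 T × (∀ Y → 𝓛 Y → T ≤ Y → Y ≤ T)

  Samp : SVSet → SV I → Set
  Samp 𝒦 S = ∃[ Y ] (𝒦 Y × S ≤ Y)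

  -- [S] : vertex set of the subgraph of the tope graph of 𝓛 induced by
  -- the topes T ≥ S  (edges: topes differing in exactly one coordinate)
  Box : SVSet → SV I → SVSet
  Box 𝓛 S T = Tope 𝓛 T × S ≤ T


record IsCOM {n : ℕ} (𝓛 : SVSet {Fin n}) : Set where
  field
    -- 𝓛 is a *set* of sign vectors: membership respects pointwise equality
    ext : ∀ X Y → X ≈ Y → 𝓛 X → 𝓛 Y
    FS  : ∀ X Y → 𝓛 X → 𝓛 Y → 𝓛 (X ∘ (- Y))
    SE  : ∀ X Y → 𝓛 X → 𝓛 Y → ∀ e → Sep X Y e →
          ∃[ Z ] (𝓛 Z × Z e ≡ ⊙ × (∀ f → ¬ Sep X Y f → Z f ≡ (X ∘ Y) f))
    simple₁ : ∀ e s → ∃[ X ] (𝓛 X × X e ≡ s)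
    simple₂ : ∀ e f → e ≢ f →
              ∃[ X ] ∃[ Y ] (𝓛 X × 𝓛 Y × X e *ˢ X f ≡ ⊕ × Y e *ˢ Y f ≡ ⊖)

module _ {n : ℕ} where

  -- support membership: e ∈ underline X  iff  X e ≠ 0;
  -- the complement U ∖ underline X is the subtype of coordinates with X e = 0
  Zeros : SV (Fin n) → Set
  Zeros X = Σ (Fin n) (λ e → X e ≡ ⊙)

  restrict : (X : SV (Fin n)) → SV (Fin n) → SV (Zeros X)
  restrict X Y p = Y (proj₁ p)

  Face : SVSet {Fin n} → SV (Fin n) → SVSet {Fin n}
  Face 𝓛 X Y = 𝓛 Y × X ≤ Y

  Contr : SVSet {Fin n} → (X : SV (Fin n)) → SVSet {Zeros X}
  Contr 𝓛 X W = ∃[ Y ] (𝓛 Y × W ≈ restrict X Y)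

-- A graph is given by a vertex set P of sign vectors over coordinates I,
-- where each coordinate i carries its label lab i ∈ U (for I = U ∖ A this
-- is the inclusion).

EdgeAt : ∀ {n} {I : Set} → (I → Fin n) → Fin n → SV I → SV I → Set
EdgeAt lab e V W = (∃[ i ] (lab i ≡ e × V i ≢ W i)) × (∀ i → lab i ≢ e → V i ≡ W i)

record UIso {n} {I J : Set} (labI : I → Fin n) (labJ : J → Fin n)
            (P : SVSet {I}) (Q : SVSet {J}) : Set where
  field
    to      : Σ (SV I) P → Σ (SV J) Q
    from    : Σ (SV J) Q → Σ (SV I) P
    to-resp   : ∀ v w → proj₁ v ≈ proj₁ w → proj₁ (to v) ≈ proj₁ (to w)
    from-resp : ∀ v w → proj₁ v ≈ proj₁ w → proj₁ (from v) ≈ proj₁ (from w)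
    from-to : ∀ v → proj₁ (from (to v)) ≈ proj₁ v
    to-from : ∀ w → proj₁ (to (from w)) ≈ proj₁ w
    edges   : ∀ v v' e → EdgeAt labI e (proj₁ v) (proj₁ v')
                         ⇔ EdgeAt labJ e (proj₁ (to v)) (proj₁ (to v'))

UIsomorphic : ∀ {n} {I J : Set} (labI : I → Fin n) (labJ : J → Fin n)
              (P : SVSet {I}) (Q : SVSet {J}) → Set
UIsomorphic labI labJ P Q = UIso labI labJ P Q

-- The topes of a COM are exactly its elements without zero coordinates: composing a
-- tope T with an element V having V_e ≠ 0 stays in 𝓛 and lies above T, so
-- maximality forces T_e ≠ 0. Hence every element, and so every sample, lies below a
-- tope, and the same holds in the contraction 𝓜(X). A tope above X ∘ S is above X,
-- so it agrees with X on the support of X and is determined by its restriction to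
-- the zero set of X; conversely a tope W of 𝓜(X) above the restriction of X ∘ S,
-- realised as W = Y ∖ X with Y ∈ 𝓛, extends to the tope X ∘ Y. Restriction therefore
-- matches the two boxes, and it preserves edges because two topes above X can only
-- differ on the zero set of X. Finally Sep(X, S) = ∅ makes X ∘ S the join of X and S.
module Submission where

open import Defs
open import Data.Nat using (ℕ)
open import Data.Fin using (Fin)
open import Data.Product using (Σ; ∃-syntax; _×_; _,_; proj₁)
open import Function.Bundles using (_⇔_; mk⇔; Equivalence)
open import Data.List using (List; []; _∷_; allFin)
open import Data.List.Membership.Propositional using (_∈_)
open import Data.List.Membership.Propositional.Properties using (∈-allFin)
open import Data.List.Relation.Unary.Any using (here; there)
open import Data.Empty using (⊥-elim)
open import Relation.Nullary using (Dec; yes; no)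
open import Relation.Binary.PropositionalEquality
  using (_≡_; _≢_; refl; sym; trans; subst; subst₂; cong₂)

_≟⊙ : ∀ s → Dec (s ≡ ⊙)
⊖ ≟⊙ = no λ ()
⊙ ≟⊙ = yes refl
⊕ ≟⊙ = no λ ()

≡⇒≤ˢ : ∀ {x y} → x ≡ y → x ≤ˢ y
≡⇒≤ˢ refl = refl≤

≤ˢ-trans : ∀ {x y z} → x ≤ˢ y → y ≤ˢ z → x ≤ˢ z
≤ˢ-trans ⊙≤ _ = ⊙≤
≤ˢ-trans refl≤ y≤z = y≤z

≤ˢ-⊙ : ∀ {x} → x ≤ˢ ⊙ → x ≡ ⊙
≤ˢ-⊙ ⊙≤ = refl
≤ˢ-⊙ refl≤ = refl

≤ˢ-nonzero : ∀ {x y} → x ≢ ⊙ → x ≤ˢ y → y ≡ x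
≤ˢ-nonzero x≢⊙ ⊙≤ = ⊥-elim (x≢⊙ refl)
≤ˢ-nonzero x≢⊙ refl≤ = refl

∘ˢ-⊙ˡ : ∀ {x} y → x ≡ ⊙ → (x ∘ˢ y) ≡ y
∘ˢ-⊙ˡ y refl = refl

≤ˢ-∘ˢ : ∀ x y → x ≤ˢ (x ∘ˢ y)
≤ˢ-∘ˢ ⊖ y = refl≤
≤ˢ-∘ˢ ⊙ y = ⊙≤
≤ˢ-∘ˢ ⊕ y = refl≤

∘ˢ-nonzero : ∀ x y → (x ≡ ⊙ → y ≢ ⊙) → (x ∘ˢ y) ≢ ⊙
∘ˢ-nonzero ⊖ y _ ()
∘ˢ-nonzero ⊙ y y≢⊙ = y≢⊙ refl
∘ˢ-nonzero ⊕ y _ ()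

∘ˢ-congʳ : ∀ x {y y'} → (x ≡ ⊙ → y ≡ y') → (x ∘ˢ y) ≡ (x ∘ˢ y')
∘ˢ-congʳ ⊖ _ = refl
∘ˢ-congʳ ⊙ y≡y' = y≡y' refl
∘ˢ-congʳ ⊕ _ = refl

∘ˢ-monoʳ : ∀ x {y y'} → (x ≡ ⊙ → y ≤ˢ y') → (x ∘ˢ y) ≤ˢ (x ∘ˢ y')
∘ˢ-monoʳ ⊖ _ = refl≤
∘ˢ-monoʳ ⊙ y≤y' = y≤y' refl
∘ˢ-monoʳ ⊕ _ = refl≤

∘ˢ-absorb : ∀ {x y} → x ≤ˢ y → (x ∘ˢ y) ≡ y
∘ˢ-absorb ⊙≤ = refl
∘ˢ-absorb {⊖} refl≤ = refl
∘ˢ-absorb {⊙} refl≤ = refl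
∘ˢ-absorb {⊕} refl≤ = refl

∘ˢ-lub : ∀ x {y z} → x ≤ˢ z → y ≤ˢ z → (x ∘ˢ y) ≤ˢ z
∘ˢ-lub ⊖ x≤z _ = x≤z
∘ˢ-lub ⊙ _ y≤z = y≤z
∘ˢ-lub ⊕ x≤z _ = x≤z

∘ˢ-≤ˢ⇒≤ˢˡ : ∀ x {y z} → (x ∘ˢ y) ≤ˢ z → x ≤ˢ z
∘ˢ-≤ˢ⇒≤ˢˡ ⊖ h = h
∘ˢ-≤ˢ⇒≤ˢˡ ⊙ _ = ⊙≤
∘ˢ-≤ˢ⇒≤ˢˡ ⊕ h = h

∘ˢ-≤ˢ⇒≤ˢʳ : ∀ x y {z} → (x *ˢ y) ≢ ⊖ → (x ∘ˢ y) ≤ˢ z → y ≤ˢ z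
∘ˢ-≤ˢ⇒≤ˢʳ ⊖ ⊖ _ h = h
∘ˢ-≤ˢ⇒≤ˢʳ ⊖ ⊙ _ _ = ⊙≤
∘ˢ-≤ˢ⇒≤ˢʳ ⊖ ⊕ sep _ = ⊥-elim (sep refl)
∘ˢ-≤ˢ⇒≤ˢʳ ⊙ y _ h = h
∘ˢ-≤ˢ⇒≤ˢʳ ⊕ ⊖ sep _ = ⊥-elim (sep refl)
∘ˢ-≤ˢ⇒≤ˢʳ ⊕ ⊙ _ _ = ⊙≤
∘ˢ-≤ˢ⇒≤ˢʳ ⊕ ⊕ _ h = h

∘ˢ-∘ˢ-neg : ∀ x y → (x ∘ˢ (-ˢ (x ∘ˢ (-ˢ y)))) ≡ (x ∘ˢ y)
∘ˢ-∘ˢ-neg ⊖ y = refl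
∘ˢ-∘ˢ-neg ⊙ ⊖ = refl
∘ˢ-∘ˢ-neg ⊙ ⊙ = refl
∘ˢ-∘ˢ-neg ⊙ ⊕ = refl
∘ˢ-∘ˢ-neg ⊕ y = refl

module _ {I : Set} where

  Full : SV I → Set
  Full T = ∀ i → T i ≢ ⊙

  ≤-refl : ∀ {X : SV I} → X ≤ X
  ≤-refl _ = refl≤

  ≤-trans : ∀ {X Y Z : SV I} → X ≤ Y → Y ≤ Z → X ≤ Z
  ≤-trans X≤Y Y≤Z i = ≤ˢ-trans (X≤Y i) (Y≤Z i)

  ≤-∘ : ∀ (X Y : SV I) → X ≤ (X ∘ Y)
  ≤-∘ X Y i = ≤ˢ-∘ˢ (X i) (Y i)

  ∘-monoʳ-≤ : ∀ (X : SV I) {Y Y'} → Y ≤ Y' → (X ∘ Y) ≤ (X ∘ Y')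
  ∘-monoʳ-≤ X Y≤Y' i = ∘ˢ-monoʳ (X i) (λ _ → Y≤Y' i)

  ≤-agree-on-support : ∀ {X V V' : SV I} → X ≤ V → X ≤ V' →
                       ∀ i → X i ≢ ⊙ → V i ≡ V' i
  ≤-agree-on-support X≤V X≤V' i Xi≢⊙ =
    trans (≤ˢ-nonzero Xi≢⊙ (X≤V i)) (sym (≤ˢ-nonzero Xi≢⊙ (X≤V' i)))

  ∘-≤⇔ : ∀ {X S T : SV I} → SepEmpty X S → (X ∘ S) ≤ T ⇔ (X ≤ T × S ≤ T)
  ∘-≤⇔ {X} {S} X⊥S = mk⇔
    (λ XS≤T → (λ i → ∘ˢ-≤ˢ⇒≤ˢˡ (X i) (XS≤T i)) , (λ i → ∘ˢ-≤ˢ⇒≤ˢʳ (X i) (S i) (X⊥S i) (XS≤T i)))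
    (λ { (X≤T , S≤T) i → ∘ˢ-lub (X i) (X≤T i) (S≤T i) })

  Box-∘ : ∀ {𝒦 : SVSet} {X S T : SV I} → SepEmpty X S →
          Box 𝒦 (X ∘ S) T ⇔ (Box 𝒦 X T × Box 𝒦 S T)
  Box-∘ X⊥S = mk⇔
    (λ { (tT , XS≤T) → let (X≤T , S≤T) = Equivalence.to (∘-≤⇔ X⊥S) XS≤T in (tT , X≤T) , (tT , S≤T) })
    (λ { ((tT , X≤T) , (_ , S≤T)) → tT , Equivalence.from (∘-≤⇔ X⊥S) (X≤T , S≤T) })

  full⇒tope : ∀ {𝒦 : SVSet} {T : SV I} → 𝒦 T → Full T → Tope 𝒦 T
  full⇒tope kT full = kT , λ Y _ T≤Y i → ≡⇒≤ˢ (≤ˢ-nonzero (full i) (T≤Y i))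

module _ {I : Set} {𝒦 : SVSet {I}}
         (∘-closed : ∀ {Y Z} → 𝒦 Y → 𝒦 Z → 𝒦 (Y ∘ Z))
         (nonzero-at : ∀ i → ∃[ V ] (𝒦 V × V i ≢ ⊙)) where

  tope⇒full : ∀ {T} → Tope 𝒦 T → Full T
  tope⇒full {T} (kT , maximal) i Ti≡⊙ with nonzero-at i
  ... | V , kV , Vi≢⊙ = Vi≢⊙ (trans (sym (∘ˢ-⊙ˡ (V i) Ti≡⊙)) (≤ˢ-⊙ TVi≤⊙))
    where
      TVi≤⊙ : (T i ∘ˢ V i) ≤ˢ ⊙
      TVi≤⊙ = subst ((T i ∘ˢ V i) ≤ˢ_) Ti≡⊙ (maximal (T ∘ V) (∘-closed kT kV) (≤-∘ T V) i)

  nonzero-above-on : ∀ {Y} → 𝒦 Y → (l : List I) →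
                     ∃[ F ] (𝒦 F × Y ≤ F × (∀ i → i ∈ l → F i ≢ ⊙))
  nonzero-above-on kY [] = _ , kY , ≤-refl , λ _ ()
  nonzero-above-on kY (j ∷ l) with nonzero-above-on kY l | nonzero-at j
  ... | F , kF , Y≤F , F≢⊙ | V , kV , Vj≢⊙ =
    F ∘ V , ∘-closed kF kV , ≤-trans Y≤F (≤-∘ F V) , FV≢⊙
    where
      FV≢⊙ : ∀ i → i ∈ j ∷ l → (F ∘ V) i ≢ ⊙
      FV≢⊙ i (here refl) = ∘ˢ-nonzero (F i) (V i) (λ _ → Vj≢⊙)
      FV≢⊙ i (there i∈l) = ∘ˢ-nonzero (F i) (V i) (λ Fi≡⊙ → ⊥-elim (F≢⊙ i i∈l Fi≡⊙))

  tope-above : (l : List I) → (∀ i → i ∈ l) →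
               ∀ {Y} → 𝒦 Y → ∃[ T ] (Tope 𝒦 T × Y ≤ T)
  tope-above l complete kY with nonzero-above-on kY l
  ... | F , kF , Y≤F , F≢⊙ = F , full⇒tope kF (λ i → F≢⊙ i (complete i)) , Y≤F

module _ {n : ℕ} {𝓛 : SVSet {Fin n}} (C : IsCOM 𝓛) where
  open IsCOM C

  -- X ∘ Y = X ∘ -(X ∘ -Y), obtained by applying (FS) twice.
  ∘-closed : ∀ {X Y} → 𝓛 X → 𝓛 Y → 𝓛 (X ∘ Y)
  ∘-closed {X} {Y} lX lY =
    ext _ _ (λ e → ∘ˢ-∘ˢ-neg (X e) (Y e)) (FS X (X ∘ (- Y)) lX (FS X Y lX lY))

  nonzero-at : ∀ i → ∃[ V ] (𝓛 V × V i ≢ ⊙)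
  nonzero-at i with simple₁ i ⊕
  ... | V , lV , Vi≡⊕ = V , lV , subst (_≢ ⊙) (sym Vi≡⊕) λ ()

  Contr-∘-closed : ∀ {X W W'} → Contr 𝓛 X W → Contr 𝓛 X W' → Contr 𝓛 X (W ∘ W')
  Contr-∘-closed (Y , lY , W≈Y) (Y' , lY' , W'≈Y') =
    Y ∘ Y' , ∘-closed lY lY' , λ i → cong₂ _∘ˢ_ (W≈Y i) (W'≈Y' i)

  Contr-nonzero-at : ∀ {X} i → ∃[ W ] (Contr 𝓛 X W × W i ≢ ⊙)
  Contr-nonzero-at {X} (i , _) with nonzero-at i
  ... | V , lV , Vi≢⊙ = restrict X V , (V , lV , λ _ → refl) , Vi≢⊙

  COM-tope⇒full : ∀ {T} → Tope 𝓛 T → Full T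
  COM-tope⇒full = tope⇒full ∘-closed nonzero-at

  Contr-tope⇒full : ∀ {X W} → Tope (Contr 𝓛 X) W → Full W
  Contr-tope⇒full = tope⇒full Contr-∘-closed Contr-nonzero-at

  Samp⇒Box-nonempty : ∀ {Z} → Samp 𝓛 Z → ∃[ T ] Box 𝓛 Z T
  Samp⇒Box-nonempty (Y , lY , Z≤Y) with tope-above ∘-closed nonzero-at (allFin n) ∈-allFin lY
  ... | T , tT , Y≤T = T , tT , ≤-trans Z≤Y Y≤T

EdgeAt-restrict : ∀ {n} {X V V' : SV (Fin n)} {e} → X ≤ V → X ≤ V' →
                  EdgeAt (λ i → i) e V V' ⇔ EdgeAt proj₁ e (restrict X V) (restrict X V')
EdgeAt-restrict {X = X} {V} {V'} {e} X≤V X≤V' = mk⇔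
  (λ { ((i , i≡e , Vi≢V'i) , agree-off-e) →
         ((i , differs⇒zero i Vi≢V'i) , i≡e , Vi≢V'i) , λ j j≢e → agree-off-e (proj₁ j) j≢e })
  (λ { (((i , _) , i≡e , Vi≢V'i) , agree-off-e) → (i , i≡e , Vi≢V'i) , extend agree-off-e })
  where
    differs⇒zero : ∀ i → V i ≢ V' i → X i ≡ ⊙
    differs⇒zero i Vi≢V'i with X i ≟⊙
    ... | yes Xi≡⊙ = Xi≡⊙
    ... | no Xi≢⊙ = ⊥-elim (Vi≢V'i (≤-agree-on-support X≤V X≤V' i Xi≢⊙))

    extend : (∀ (j : Zeros X) → proj₁ j ≢ e → V (proj₁ j) ≡ V' (proj₁ j)) →
             ∀ j → j ≢ e → V j ≡ V' j
    extend agree-off-e j j≢e with X j ≟⊙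
    ... | yes Xj≡⊙ = agree-off-e (j , Xj≡⊙) j≢e
    ... | no Xj≢⊙ = ≤-agree-on-support X≤V X≤V' j Xj≢⊙

module _ {n : ℕ} {𝓛 : SVSet {Fin n}} (C : IsCOM 𝓛)
         {X : SV (Fin n)} (lX : 𝓛 X) (S : SV (Fin n)) where

  private
    P : SVSet {Fin n}
    P = Box 𝓛 (X ∘ S)

    Q : SVSet {Zeros X}
    Q = Box (Contr 𝓛 X) (restrict X (X ∘ S))

    above-X : (v : Σ (SV (Fin n)) P) → X ≤ proj₁ v
    above-X (T , _ , XS≤T) i = ∘ˢ-≤ˢ⇒≤ˢˡ (X i) (XS≤T i)

    restrict-box : Σ (SV (Fin n)) P → Σ (SV (Zeros X)) Q
    restrict-box (T , tT@(lT , _) , XS≤T) =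
      restrict X T ,
      full⇒tope (T , lT , λ _ → refl) (λ i → COM-tope⇒full C tT (proj₁ i)) ,
      λ i → XS≤T (proj₁ i)

    extend-box : Σ (SV (Zeros X)) Q → Σ (SV (Fin n)) P
    extend-box (W , tW@((Y , lY , W≈Y) , _) , XS≤W) =
      X ∘ Y , full⇒tope (∘-closed C lX lY) XY-full , XS≤XY
      where
        XY-full : Full (X ∘ Y)
        XY-full i = ∘ˢ-nonzero (X i) (Y i)
          (λ Xi≡⊙ → subst (_≢ ⊙) (W≈Y (i , Xi≡⊙)) (Contr-tope⇒full C tW (i , Xi≡⊙)))

        XS≤XY : (X ∘ S) ≤ (X ∘ Y)
        XS≤XY i = ∘ˢ-monoʳ (X i) (λ Xi≡⊙ →
          subst₂ _≤ˢ_ (∘ˢ-⊙ˡ (S i) Xi≡⊙) (W≈Y (i , Xi≡⊙)) (XS≤W (i , Xi≡⊙)))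

  box-UIso : UIso (λ i → i) proj₁ P Q
  box-UIso = record
    { to = restrict-box
    ; from = extend-box
    ; to-resp = λ _ _ T≈T' i → T≈T' (proj₁ i)
    ; from-resp = λ { (_ , ((Y , _ , W≈Y) , _) , _) (_ , ((Y' , _ , W'≈Y') , _) , _) W≈W' i →
        ∘ˢ-congʳ (X i) (λ Xi≡⊙ →
          trans (sym (W≈Y (i , Xi≡⊙))) (trans (W≈W' (i , Xi≡⊙)) (W'≈Y' (i , Xi≡⊙)))) }
    ; from-to = λ v i → ∘ˢ-absorb (above-X v i)
    ; to-from = λ { (_ , ((Y , _ , W≈Y) , _) , _) (i , Xi≡⊙) →
        trans (∘ˢ-⊙ˡ (Y i) Xi≡⊙) (sym (W≈Y (i , Xi≡⊙))) }
    ; edges = λ v v' _ → EdgeAt-restrict (above-X v) (above-X v')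
    }

lemma23 : ∀ {n : ℕ} (𝓛 : SVSet {Fin n}) → IsCOM 𝓛 →
    ∀ (X S : SV (Fin n)) → 𝓛 X → Samp 𝓛 S → SepEmpty X S →
    Samp (Face 𝓛 X) (X ∘ S)
    × Samp (Contr 𝓛 X) (restrict X (X ∘ S))
    × UIsomorphic (λ i → i) proj₁
        (Box 𝓛 (X ∘ S)) (Box (Contr 𝓛 X) (restrict X (X ∘ S)))
    × (∀ T → Box 𝓛 (X ∘ S) T ⇔ (Box 𝓛 X T × Box 𝓛 S T))
    × (∃[ T ] Box 𝓛 (X ∘ S) T)
lemma23 𝓛 C X S lX (Y , lY , S≤Y) X⊥S =
    (X ∘ Y , (lXY , ≤-∘ X Y) , XS≤XY)
  , (restrict X (X ∘ Y) , (X ∘ Y , lXY , λ _ → refl) , λ i → XS≤XY (proj₁ i))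
  , box-UIso C lX S
  , (λ T → Box-∘ X⊥S)
  , Samp⇒Box-nonempty C (X ∘ Y , lXY , XS≤XY)
  where
    lXY : 𝓛 (X ∘ Y)
    lXY = ∘-closed C lX lY

    XS≤XY : (X ∘ S) ≤ (X ∘ Y)
    XS≤XY = ∘-monoʳ-≤ X S≤Y
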